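{- Let $k,m,n\ge1$ and for $1\le i\le n$ let $a^i_1,\dots,a^i_m\subseteq[k]$. Then in $\mathrm{Sym}^m\langle P[k]\rangle$, $$\bigcup_{i=1}^n\{a^i_1,\dots,a^i_m\}=\frac{1}{(m!)^{n-1}}\sum_{\sigma\in\{\mathrm{id}\}\times S_m^{n-1}}\Big\{\bigcup_{i=1}^n a^i_{\sigma_i(1)},\dots,\bigcup_{i=1}^n a^i_{\sigma_i(m)}\Big\},$$ where $\sigma=(\sigma_1,\dots,\sigma_n)$ with $\sigma_1=\mathrm{id}$ and $\sigma_2,\dots,\sigma_n\in S_m$.
   Context: Work over $\mathbb{R}$. $[k]=\{1,\dots,k\}$; $\langle P[k]\rangle$ is the real vector space with basis the subsets of $[k]$, with union the bilinear extension of set union. $\langle P[k]\rangle^{\otimes m}$ has componentwise union, and $S_m$ acts by permuting tensor factors. $\mathrm{Sym}^m\langle P[k]\rangle=\langle P[k]\rangle^{\otimes m}/S_m$ is the coinvariant space (quotient by the span of $\tau v-v$), and $\{a_1,\dots,a_m\}$ denotes the class of $a_1\otimes\cdots\otimes a_m$. Union on $\mathrm{Sym}^m\langle P[k]\rangle$ is $\bar u\cup\bar v=\frac{1}{m!}\sum_{\tau\in S_m}\overline{u\cup\tau v}$, and $\bigcup_{i=1}^n$ denotes the iterated union $(\cdots(x_1\cup x_2)\cup\cdots)\cup x_n$.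
   Formalization: The scalars of ⟨P[k]⟩, of its tensor power and of Sym^m⟨P[k]⟩ are taken in ℚ rather than ℝ. -}

module Defs where

open import Data.Nat as ℕ using (ℕ; zero; suc; _!; _^_)
open import Data.Nat.Properties using (_!≢0; m^n≢0)
open import Data.Integer using (+_)
open import Data.Rational as ℚ using (ℚ; 0ℚ; 1ℚ; _/_)
open import Data.Fin using (Fin; zero; suc; inject₁; fromℕ; _≟_)
open import Data.Fin.Properties using (all?)
open import Data.Fin.Subset using (Subset; _∪_)
open import Data.Fin.Permutation using (Permutation′; _⟨$⟩ʳ_)
open import Data.Vec.Properties using (≡-dec)
import Data.Bool.Properties as BoolP
open import Data.List using (List; []; _∷_; map; concatMap; filter; allFin; foldr; _++_)
open import Data.Product using (_×_; _,_; ∃)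
open import Data.Vec.Functional as VF using ()
open import Relation.Nullary using (Dec; does)
open import Relation.Nullary.Decidable using (_→-dec_)
open import Relation.Binary.PropositionalEquality using (_≡_)
open import Data.Bool using (if_then_else_)
open import Function using (id; _∘_)

-- A basis tensor a₁ ⊗ ⋯ ⊗ aₘ of ⟨P[k]⟩^{⊗m}: an m-tuple of subsets of [k].
Tensor : ℕ → ℕ → Set
Tensor m k = Fin m → Subset k

_∪ᵗ_ : ∀ {m k} → Tensor m k → Tensor m k → Tensor m k
(x ∪ᵗ y) i = x i ∪ y i

_≟ᵗ_ : ∀ {m k} (x y : Tensor m k) → Dec (∀ i → x i ≡ y i)
x ≟ᵗ y = all? (λ i → ≡-dec BoolP._≟_ (x i) (y i))

-- Elements of ⟨P[k]⟩^{⊗m} (scalars in ℚ): formal linear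
-- combinations of basis tensors.
Vect : ℕ → ℕ → Set
Vect m k = List (ℚ × Tensor m k)

coeff : ∀ {m k} → Vect m k → Tensor m k → ℚ
coeff [] z = 0ℚ
coeff ((c , x) ∷ v) z = if does (x ≟ᵗ z) then c ℚ.+ coeff v z else coeff v z

_≐_ : ∀ {m k} → Vect m k → Vect m k → Set
u ≐ v = ∀ z → coeff u z ≡ coeff v z

basis : ∀ {m k} → Tensor m k → Vect m k
basis x = (1ℚ , x) ∷ []

scale : ∀ {m k} → ℚ → Vect m k → Vect m k
scale c = map (λ { (d , x) → (c ℚ.* d , x) })

neg : ∀ {m k} → Vect m k → Vect m k
neg = scale (ℚ.- 1ℚ)

_∪ᵛ_ : ∀ {m k} → Vect m k → Vect m k → Vect m k
u ∪ᵛ v = concatMap (λ { (c , x) → map (λ { (d , y) → (c ℚ.* d , x ∪ᵗ y) }) v }) u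

act : ∀ {m k} → (Fin m → Fin m) → Tensor m k → Tensor m k
act τ x = x ∘ τ

actᵛ : ∀ {m k} → (Fin m → Fin m) → Vect m k → Vect m k
actᵛ τ = map (λ { (c , x) → (c , act τ x) })

-- Coinvariant relation: u ~ v in Sym^m⟨P[k]⟩ iff u − v lies in the span of
-- the vectors τw − w; since basis tensors span, this span is the span of
-- τx − x for basis tensors x, so u − v = Σ_j c_j (τ_j x_j − x_j).
spanElt : ∀ {m k} → List (ℚ × Permutation′ m × Tensor m k) → Vect m k
spanElt [] = []
spanElt ((c , τ , x) ∷ l) = (c , act (τ ⟨$⟩ʳ_) x) ∷ (ℚ.- c , x) ∷ spanElt l

_~ˢ_ : ∀ {m k} → Vect m k → Vect m k → Set
_~ˢ_ {m} {k} u v = ∃ λ (l : List (ℚ × Permutation′ m × Tensor m k)) → (u ++ neg v) ≐ spanElt l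

allFuns : ∀ {A : Set} (n : ℕ) → List A → List (Fin n → A)
allFuns zero xs = (λ ()) ∷ []
allFuns (suc n) xs = concatMap (λ a → map (λ f → a VF.∷ f) (allFuns n xs)) xs

-- The symmetric group S_m, listed once each, as the injective maps Fin m → Fin m.
Injective? : ∀ {m} (f : Fin m → Fin m) → Dec (∀ i j → f i ≡ f j → i ≡ j)
Injective? f = all? (λ i → all? (λ j → (f i ≟ f j) →-dec (i ≟ j)))

Sym : (m : ℕ) → List (Fin m → Fin m)
Sym m = filter Injective? (allFuns m (allFin m))

invFact : ℕ → ℚ
invFact m = (+ 1 / (m !)) {{m !≢0}}

invFactPow : ℕ → ℕ → ℚ
invFactPow m n = (+ 1 / ((m !) ^ n)) {{m^n≢0 (m !) n {{m !≢0}}}}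

sumV : ∀ {m k} → List (Vect m k) → Vect m k
sumV = foldr _++_ []

-- Union on Sym^m on representatives: ū ∪ v̄ = (1/m!) Σ_{τ ∈ S_m} class(u ∪ τv).
_∪ˢ_ : ∀ {m k} → Vect m k → Vect m k → Vect m k
_∪ˢ_ {m} u v = scale (invFact m) (sumV (map (λ τ → u ∪ᵛ actᵛ τ v) (Sym m)))

iterUnionˢ : ∀ {m k} (n : ℕ) → (Fin (suc n) → Vect m k) → Vect m k
iterUnionˢ zero x = x zero
iterUnionˢ (suc n) x = iterUnionˢ n (x ∘ inject₁) ∪ˢ x (fromℕ (suc n))

iterUnion : ∀ {k} (n : ℕ) → (Fin (suc n) → Subset k) → Subset k
iterUnion zero s = s zero
iterUnion (suc n) s = iterUnion n (s ∘ inject₁) ∪ s (fromℕ (suc n))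

Sigmas : (m n : ℕ) → List (Fin (suc n) → Fin m → Fin m)
Sigmas m n = map (λ ρ → id VF.∷ ρ) (allFuns n (Sym m))

-- The identity holds already for the representatives in ⟨P[k]⟩^{⊗m}: the coinvariant
-- relation is witnessed by the empty combination.  Induct on the number of factors: the
-- last union is (1/m!) ∑_τ U ∪ τb, where U is the iterated union of the earlier tensors.
-- By induction U is (1/m!)^{n-1} times the sum over σ' = (id, ρ), and union with a basis
-- tensor is linear, so the whole is (1/m!)^n times the sum over σ = (id, ρ, τ).
-- Linearity is exploited by comparing vectors through the linear extensions of functionals
-- on basis tensors; coefficients are the extensions of indicator functionals, while the
-- induction has to range over all functionals, since union with b changes the functional.
module Submission where

open import Defs
open import Data.Nat as ℕ using (ℕ; zero; suc; _≤_; _!)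
open import Data.Nat.Properties using (_!≢0; m^n≢0)
open import Data.Nat.Coprimality using (1-coprimeTo)
import Data.Integer as ℤ
open import Data.Rational using (ℚ; 0ℚ; 1ℚ; _+_; _*_; -_; _-_; _/_)
open import Data.Rational.Properties
open import Data.Fin using (Fin; zero; suc; inject₁; fromℕ)
open import Data.Fin.Subset using (Subset; _∪_)
open import Data.List using (List; []; _∷_; map; concatMap; _++_)
open import Data.Product using (_,_; proj₁; proj₂)
open import Data.Bool using (Bool; true; false; if_then_else_)
open import Data.Vec.Functional as VF using (init; last)
open import Function using (id; _∘_)
open import Function.Bundles using (mk⇔)
open import Relation.Nullary using (does)
open import Relation.Nullary.Decidable using (does-⇔)
open import Relation.Binary.PropositionalEquality
open import Algebra.Bundles using (CommutativeMonoid)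
open import Algebra.Properties.CommutativeSemigroup
  (CommutativeMonoid.commutativeSemigroup +-0-commutativeMonoid) using (interchange)

open ≡-Reasoning

private variable A B : Set

sumOver : List A → (A → ℚ) → ℚ
sumOver [] f = 0ℚ
sumOver (x ∷ xs) f = f x + sumOver xs f

infix 5 sumOver
syntax sumOver xs (λ x → e) = ∑[ x ∈ xs ] e

∑-cong : ∀ (xs : List A) {f g : A → ℚ} → (∀ x → f x ≡ g x) → sumOver xs f ≡ sumOver xs g
∑-cong [] f≗g = refl
∑-cong (x ∷ xs) f≗g = cong₂ _+_ (f≗g x) (∑-cong xs f≗g)

∑-++ : ∀ (xs ys : List A) f → sumOver (xs ++ ys) f ≡ sumOver xs f + sumOver ys f
∑-++ [] ys f = sym (+-identityˡ _)
∑-++ (x ∷ xs) ys f = trans (cong (f x +_) (∑-++ xs ys f)) (sym (+-assoc (f x) _ _))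

∑-map : ∀ (g : A → B) (xs : List A) f → sumOver (map g xs) f ≡ sumOver xs (f ∘ g)
∑-map g [] f = refl
∑-map g (x ∷ xs) f = cong (f (g x) +_) (∑-map g xs f)

∑-concatMap : ∀ (g : A → List B) (xs : List A) f →
              sumOver (concatMap g xs) f ≡ ∑[ x ∈ xs ] sumOver (g x) f
∑-concatMap g [] f = refl
∑-concatMap g (x ∷ xs) f =
  trans (∑-++ (g x) (concatMap g xs) f) (cong (sumOver (g x) f +_) (∑-concatMap g xs f))

*-distribˡ-∑ : ∀ c (xs : List A) f → c * sumOver xs f ≡ ∑[ x ∈ xs ] c * f x
*-distribˡ-∑ c [] f = *-zeroʳ c
*-distribˡ-∑ c (x ∷ xs) f = trans (*-distribˡ-+ c (f x) _) (cong (c * f x +_) (*-distribˡ-∑ c xs f))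

∑-zero : ∀ (xs : List A) → ∑[ x ∈ xs ] 0ℚ ≡ 0ℚ
∑-zero [] = refl
∑-zero (x ∷ xs) = trans (+-identityˡ _) (∑-zero xs)

∑-distrib-+ : ∀ (xs : List A) f g → ∑[ x ∈ xs ] (f x + g x) ≡ sumOver xs f + sumOver xs g
∑-distrib-+ [] f g = sym (+-identityˡ 0ℚ)
∑-distrib-+ (x ∷ xs) f g = trans (cong (f x + g x +_) (∑-distrib-+ xs f g)) (interchange (f x) (g x) _ _)

∑-comm : (xs : List A) (ys : List B) (f : A → B → ℚ) →
         ∑[ x ∈ xs ] ∑[ y ∈ ys ] f x y ≡ ∑[ y ∈ ys ] ∑[ x ∈ xs ] f x y
∑-comm [] ys f = sym (∑-zero ys)
∑-comm (x ∷ xs) ys f = trans (cong (sumOver ys (f x) +_) (∑-comm xs ys f)) (sym (∑-distrib-+ ys (f x) _))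

-- Both reciprocals are already in lowest terms, so their product normalises like 1/(ab).
1/-*-1/ : ∀ a b .{{_ : ℕ.NonZero a}} .{{_ : ℕ.NonZero b}} .{{_ : ℕ.NonZero (a ℕ.* b)}} →
          (ℤ.+ 1 / a) * (ℤ.+ 1 / b) ≡ ℤ.+ 1 / (a ℕ.* b)
1/-*-1/ (suc a) (suc b) =
  cong₂ _*_ (normalize-coprime (1-coprimeTo (suc a))) (normalize-coprime (1-coprimeTo (suc b)))

invFact-*-invFactPow : ∀ m n → invFact m * invFactPow m n ≡ invFactPow m (suc n)
invFact-*-invFactPow m n =
  1/-*-1/ (m !) ((m !) ℕ.^ n) {{m !≢0}} {{m^n≢0 (m !) n {{m !≢0}}}} {{m^n≢0 (m !) (suc n) {{m !≢0}}}}

module _ {m k : ℕ} where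

  linExt : (Tensor m k → ℚ) → Vect m k → ℚ
  linExt φ v = ∑[ p ∈ v ] proj₁ p * φ (proj₂ p)

  -- Tensors are functions, so without function extensionality this has to be assumed.
  Extensional : (Tensor m k → ℚ) → Set
  Extensional φ = ∀ {x y} → (∀ j → x j ≡ y j) → φ x ≡ φ y

  δ : Tensor m k → Tensor m k → ℚ
  δ z x = if does (x ≟ᵗ z) then 1ℚ else 0ℚ

  δ-extensional : ∀ z → Extensional (δ z)
  δ-extensional z {x} {y} x≗y = cong (if_then 1ℚ else 0ℚ)
    (does-⇔ (mk⇔ (λ x≗z i → trans (sym (x≗y i)) (x≗z i)) (λ y≗z i → trans (x≗y i) (y≗z i))) (x ≟ᵗ z) (y ≟ᵗ z))

  coeff≡linExt-δ : ∀ (v : Vect m k) z → coeff v z ≡ linExt (δ z) v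
  coeff≡linExt-δ [] z = refl
  coeff≡linExt-δ ((c , x) ∷ v) z = step (does (x ≟ᵗ z)) (coeff≡linExt-δ v z)
    where
    step : ∀ {r s} (b : Bool) → r ≡ s → (if b then c + r else r) ≡ c * (if b then 1ℚ else 0ℚ) + s
    step true refl = cong (_+ _) (sym (*-identityʳ c))
    step false refl = trans (sym (+-identityˡ _)) (cong (_+ _) (sym (*-zeroʳ c)))

  linExt-++ : ∀ φ (u v : Vect m k) → linExt φ (u ++ v) ≡ linExt φ u + linExt φ v
  linExt-++ φ u v = ∑-++ u v _

  linExt-scale : ∀ φ c (v : Vect m k) → linExt φ (scale c v) ≡ c * linExt φ v
  linExt-scale φ c [] = sym (*-zeroʳ c)
  linExt-scale φ c ((d , x) ∷ v) =
    trans (cong₂ _+_ (*-assoc c d (φ x)) (linExt-scale φ c v)) (sym (*-distribˡ-+ c _ _))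

  linExt-neg : ∀ φ (v : Vect m k) → linExt φ (neg v) ≡ - linExt φ v
  linExt-neg φ v = begin
    linExt φ (neg v)      ≡⟨ linExt-scale φ (- 1ℚ) v ⟩
    - 1ℚ * linExt φ v     ≡⟨ sym (neg-distribˡ-* 1ℚ (linExt φ v)) ⟩
    - (1ℚ * linExt φ v)   ≡⟨ cong -_ (*-identityˡ (linExt φ v)) ⟩
    - linExt φ v          ∎

  linExt-sumV : ∀ φ (vs : List (Vect m k)) → linExt φ (sumV vs) ≡ sumOver vs (linExt φ)
  linExt-sumV φ [] = refl
  linExt-sumV φ (v ∷ vs) = trans (linExt-++ φ v (sumV vs)) (cong (linExt φ v +_) (linExt-sumV φ vs))

  linExt-sumV-basis : ∀ φ (f : A → Tensor m k) xs →
                      linExt φ (sumV (map (basis ∘ f) xs)) ≡ ∑[ x ∈ xs ] φ (f x)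
  linExt-sumV-basis φ f xs =
    trans (linExt-sumV φ (map (basis ∘ f) xs))
          (trans (∑-map (basis ∘ f) xs (linExt φ)) (∑-cong xs λ x → trans (+-identityʳ _) (*-identityˡ _)))

  linExt-∪ᵛ-basis : ∀ φ (u : Vect m k) y → linExt φ (u ∪ᵛ basis y) ≡ linExt (λ x → φ (x ∪ᵗ y)) u
  linExt-∪ᵛ-basis φ [] y = refl
  linExt-∪ᵛ-basis φ ((c , x) ∷ u) y =
    cong₂ _+_ (cong (_* φ (x ∪ᵗ y)) (*-identityʳ c)) (linExt-∪ᵛ-basis φ u y)

  linExt-∪ˢ-basis : ∀ φ (u : Vect m k) y →
                    linExt φ (u ∪ˢ basis y) ≡ invFact m * (∑[ τ ∈ Sym m ] linExt (λ x → φ (x ∪ᵗ (y ∘ τ))) u)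
  linExt-∪ˢ-basis φ u y = begin
    linExt φ (u ∪ˢ basis y)
      ≡⟨ linExt-scale φ (invFact m) (sumV (map union (Sym m))) ⟩
    invFact m * linExt φ (sumV (map union (Sym m)))
      ≡⟨ cong (invFact m *_) (trans (linExt-sumV φ (map union (Sym m))) (∑-map union (Sym m) (linExt φ))) ⟩
    invFact m * (∑[ τ ∈ Sym m ] linExt φ (u ∪ᵛ basis (y ∘ τ)))
      ≡⟨ cong (invFact m *_) (∑-cong (Sym m) λ τ → linExt-∪ᵛ-basis φ u (y ∘ τ)) ⟩
    invFact m * (∑[ τ ∈ Sym m ] linExt (λ x → φ (x ∪ᵗ (y ∘ τ))) u)
      ∎
    where
    union : (Fin m → Fin m) → Vect m k
    union τ = u ∪ᵛ actᵛ τ (basis y)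

  linExt-δ-≡⇒~ˢ : ∀ {u v : Vect m k} → (∀ z → linExt (δ z) u ≡ linExt (δ z) v) → u ~ˢ v
  linExt-δ-≡⇒~ˢ {u} {v} u≡v = [] , λ z → begin
    coeff (u ++ neg v) z                      ≡⟨ coeff≡linExt-δ (u ++ neg v) z ⟩
    linExt (δ z) (u ++ neg v)                 ≡⟨ linExt-++ (δ z) u (neg v) ⟩
    linExt (δ z) u + linExt (δ z) (neg v)     ≡⟨ cong₂ _+_ (u≡v z) (linExt-neg (δ z) v) ⟩
    linExt (δ z) v - linExt (δ z) v           ≡⟨ +-inverseʳ (linExt (δ z) v) ⟩
    0ℚ                                        ∎

-- Defined so that (x ∷ ρ) ∷ʳ y reduces to x ∷ (ρ ∷ʳ y), which ∑-allFuns-∷ʳ relies on.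
_∷ʳ_ : ∀ {n} → (Fin n → A) → A → Fin (suc n) → A
_∷ʳ_ {n = zero} ρ x = x VF.∷ ρ
_∷ʳ_ {n = suc n} ρ x = ρ zero VF.∷ ((ρ ∘ suc) ∷ʳ x)

init-∷ʳ : ∀ {n} (ρ : Fin n → A) x i → init (ρ ∷ʳ x) i ≡ ρ i
init-∷ʳ {n = suc n} ρ x zero = refl
init-∷ʳ {n = suc n} ρ x (suc i) = init-∷ʳ (ρ ∘ suc) x i

last-∷ʳ : ∀ {n} (ρ : Fin n → A) x → last (ρ ∷ʳ x) ≡ x
last-∷ʳ {n = zero} ρ x = refl
last-∷ʳ {n = suc n} ρ x = last-∷ʳ (ρ ∘ suc) x

module _ (xs : List A) where

  ∑-allFuns-∷ : ∀ n (F : (Fin (suc n) → A) → ℚ) →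
                sumOver (allFuns (suc n) xs) F ≡ ∑[ x ∈ xs ] ∑[ ρ ∈ allFuns n xs ] F (x VF.∷ ρ)
  ∑-allFuns-∷ n F =
    trans (∑-concatMap _ xs F) (∑-cong xs λ x → ∑-map (x VF.∷_) (allFuns n xs) F)

  ∑-allFuns-∷ʳ : ∀ n (F : (Fin (suc n) → A) → ℚ) →
                 sumOver (allFuns (suc n) xs) F ≡ ∑[ ρ ∈ allFuns n xs ] ∑[ x ∈ xs ] F (ρ ∷ʳ x)
  ∑-allFuns-∷ʳ zero F = trans (∑-allFuns-∷ zero F) (∑-comm xs (allFuns zero xs) λ x ρ → F (x VF.∷ ρ))
  ∑-allFuns-∷ʳ (suc n) F = begin
    sumOver (allFuns (suc (suc n)) xs) F
      ≡⟨ ∑-allFuns-∷ (suc n) F ⟩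
    ∑[ x ∈ xs ] ∑[ ρ ∈ allFuns (suc n) xs ] F (x VF.∷ ρ)
      ≡⟨ ∑-cong xs (λ x → ∑-allFuns-∷ʳ n (F ∘ (x VF.∷_))) ⟩
    ∑[ x ∈ xs ] ∑[ ρ ∈ allFuns n xs ] ∑[ y ∈ xs ] F ((x VF.∷ ρ) ∷ʳ y)
      ≡⟨ sym (∑-allFuns-∷ n _) ⟩
    ∑[ ρ ∈ allFuns (suc n) xs ] ∑[ y ∈ xs ] F (ρ ∷ʳ y)
      ∎

iterUnion-cong : ∀ {k} n {s t : Fin (suc n) → Subset k} → (∀ i → s i ≡ t i) → iterUnion n s ≡ iterUnion n t
iterUnion-cong zero s≗t = s≗t zero
iterUnion-cong (suc n) s≗t = cong₂ _∪_ (iterUnion-cong n (s≗t ∘ inject₁)) (s≗t (fromℕ (suc n)))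

unionTensor : ∀ {m k} n → (Fin (suc n) → Tensor m k) → (Fin (suc n) → Fin m → Fin m) → Tensor m k
unionTensor n a σ j = iterUnion n (λ i → a i (σ i j))

unionTensor-∷ʳ : ∀ {m k} n (a : Fin (suc (suc n)) → Tensor m k) σ τ j →
                 unionTensor (suc n) a (σ ∷ʳ τ) j ≡ (unionTensor n (init a) σ ∪ᵗ (last a ∘ τ)) j
unionTensor-∷ʳ n a σ τ j =
  cong₂ _∪_ (iterUnion-cong n λ i → cong (λ f → a (inject₁ i) (f j)) (init-∷ʳ σ τ i))
            (cong (λ f → last a (f j)) (last-∷ʳ σ τ))

linExt-iterUnionˢ : ∀ {m k} n (a : Fin (suc n) → Tensor m k) φ → Extensional φ →
                    linExt φ (iterUnionˢ n (basis ∘ a))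
                      ≡ invFactPow m n * (∑[ ρ ∈ allFuns n (Sym m) ] φ (unionTensor n a (id VF.∷ ρ)))
linExt-iterUnionˢ zero a φ φ-ext = trans (cong (_+ 0ℚ) (*-identityˡ (φ (a zero)))) (sym (*-identityˡ (φ (a zero) + 0ℚ)))
linExt-iterUnionˢ {m} (suc n) a φ φ-ext = begin
  linExt φ (iterUnionˢ (suc n) (basis ∘ a))
    ≡⟨ linExt-∪ˢ-basis φ (iterUnionˢ n (basis ∘ init a)) (last a) ⟩
  invFact m * (∑[ τ ∈ S ] linExt (λ x → φ (x ∪ᵗ (last a ∘ τ))) (iterUnionˢ n (basis ∘ init a)))
    ≡⟨ cong (invFact m *_) (∑-cong S λ τ →
         linExt-iterUnionˢ n (init a) _ λ x≗y → φ-ext λ j → cong (_∪ last a (τ j)) (x≗y j)) ⟩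
  invFact m * (∑[ τ ∈ S ] invFactPow m n * (∑[ ρ ∈ F ] φ (U ρ ∪ᵗ (last a ∘ τ))))
    ≡⟨ cong (invFact m *_) (sym (*-distribˡ-∑ (invFactPow m n) S _)) ⟩
  invFact m * (invFactPow m n * (∑[ τ ∈ S ] ∑[ ρ ∈ F ] φ (U ρ ∪ᵗ (last a ∘ τ))))
    ≡⟨ sym (*-assoc (invFact m) _ _) ⟩
  (invFact m * invFactPow m n) * (∑[ τ ∈ S ] ∑[ ρ ∈ F ] φ (U ρ ∪ᵗ (last a ∘ τ)))
    ≡⟨ cong₂ _*_ (invFact-*-invFactPow m n) (∑-comm S F _) ⟩
  invFactPow m (suc n) * (∑[ ρ ∈ F ] ∑[ τ ∈ S ] φ (U ρ ∪ᵗ (last a ∘ τ)))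
    ≡⟨ cong (invFactPow m (suc n) *_) (∑-cong F λ ρ → ∑-cong S λ τ →
         φ-ext (λ j → sym (unionTensor-∷ʳ n a (id VF.∷ ρ) τ j))) ⟩
  invFactPow m (suc n) * (∑[ ρ ∈ F ] ∑[ τ ∈ S ] φ (unionTensor (suc n) a (id VF.∷ (ρ ∷ʳ τ))))
    ≡⟨ cong (invFactPow m (suc n) *_) (sym (∑-allFuns-∷ʳ S n _)) ⟩
  invFactPow m (suc n) * (∑[ ρ ∈ allFuns (suc n) S ] φ (unionTensor (suc n) a (id VF.∷ ρ)))
    ∎
  where
  S = Sym m
  F = allFuns n S
  U : (Fin n → Fin m → Fin m) → Tensor m _
  U ρ = unionTensor n (init a) (id VF.∷ ρ)

theorem4p1 : (k m n : ℕ) → 1 ≤ k → 1 ≤ m →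
    (a : Fin (suc n) → Fin m → Subset k) →
    iterUnionˢ n (λ i → basis (a i))
      ~ˢ scale (invFactPow m n)
          (sumV (map (λ σ → basis (λ j → iterUnion n (λ i → a i (σ i j)))) (Sigmas m n)))
theorem4p1 k m n _ _ a = linExt-δ-≡⇒~ˢ {u = lhs} {v = rhs} λ z → begin
  linExt (δ z) lhs
    ≡⟨ linExt-iterUnionˢ n a (δ z) (δ-extensional z) ⟩
  invFactPow m n * (∑[ ρ ∈ allFuns n (Sym m) ] δ z (unionTensor n a (id VF.∷ ρ)))
    ≡⟨ cong (invFactPow m n *_) (sym (trans (linExt-sumV-basis (δ z) (unionTensor n a) (Sigmas m n))
                                            (∑-map (id VF.∷_) (allFuns n (Sym m)) (δ z ∘ unionTensor n a)))) ⟩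
  invFactPow m n * linExt (δ z) (sumV (map (basis ∘ unionTensor n a) (Sigmas m n)))
    ≡⟨ sym (linExt-scale (δ z) (invFactPow m n) (sumV (map (basis ∘ unionTensor n a) (Sigmas m n)))) ⟩
  linExt (δ z) rhs
    ∎
  where
  lhs rhs : Vect m k
  lhs = iterUnionˢ n (basis ∘ a)
  rhs = scale (invFactPow m n) (sumV (map (basis ∘ unionTensor n a) (Sigmas m n)))
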